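{- Let $n\ge2$ and let $\mathscr A$ be any orientation of $A_{n-1}$. For every $1\le u\le n-1$ the set $S_u=\{1,2,\dots,u\}$, and for every $0\le v\le n-2$ the set $\widetilde S_v=\{n,n-1,\dots,n-v\}$, is of the form $K_{\mathscr A}(D)$ for some diagonal $D$ of the labelled $(n+2)$-gon; i.e. the half spaces $\mathscr H_{S_u}$ and $\mathscr H_{\widetilde S_v}$ are $\mathscr A$-admissible.
   Context: Let $[n]=\{1,\dots,n\}$. $A_{n-1}$ is the path with vertices $\tau_1,\dots,\tau_{n-1}$ and edges $\{\tau_i,\tau_{i+1}\}$; an orientation $\mathscr A$ directs each edge. $i\in\{2,\dots,n-1\}$ is up if $\{\tau_{i-1},\tau_i\}$ is directed from $\tau_i$ to $\tau_{i-1}$, down otherwise; $1,n$ are down; $\mathrm{Do}_{\mathscr A},\mathrm{Up}_{\mathscr A}$ are the sets of down/up elements, $\overline{\mathrm{Do}}_{\mathscr A}=\mathrm{Do}_{\mathscr A}\cup\{0,n+1\}$. Labelled polygon: in a convex $(n+2)$-gon $P$ label a vertex $0$, then counterclockwise the down elements increasingly, then $n+1$, then the up elements decreasingly. A diagonal is a segment joining two non-adjacent vertices. For a diagonal $D=\{a,b\}$, $0\le a<b\le n+1$: $K_{\mathscr A}(D)=\{i\in\mathrm{Do}_{\mathscr A}:a<i<b\}$ if $a,b\in\overline{\mathrm{Do}}_{\mathscr A}$; $=\{i\in\mathrm{Do}_{\mathscr A}:a<i\}\cup\{i\in\mathrm{Up}_{\mathscr A}:b\le i\}$ if $a\in\overline{\mathrm{Do}}_{\mathscr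 A},b\in\mathrm{Up}_{\mathscr A}$; $=\mathrm{Do}_{\mathscr A}\cup\{i\in\mathrm{Up}_{\mathscr A}:i\le a\text{ or }b\le i\}$ if $a,b\in\mathrm{Up}_{\mathscr A}$; $=\{i\in\mathrm{Do}_{\mathscr A}:i<b\}\cup\{i\in\mathrm{Up}_{\mathscr A}:i\le a\}$ if $a\in\mathrm{Up}_{\mathscr A},b\in\overline{\mathrm{Do}}_{\mathscr A}$. For $\varnothing\ne K\subsetneq[n]$, $k=|K|$, $\mathscr H_K=\{x\in\mathbb R^n:(n-k)\sum_{i\in K}x_i-k\sum_{i\notin K}x_i+\tfrac{nk(n-k)}2\ge0\}$; it is $\mathscr A$-admissible if $K=K_{\mathscr A}(D)$ for some diagonal $D$. -}

module Defs where

open import Data.Nat using (ℕ; zero; suc; _+_; _∸_; _≤_; _<_; _≤ᵇ_; _<ᵇ_; _≡ᵇ_)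
open import Data.Nat.Properties using (_<?_)
open import Data.Bool using (Bool; true; false; _∧_; _∨_; not; if_then_else_)
open import Data.Fin using (Fin; fromℕ<)
open import Data.List using (List; []; _∷_; _++_; reverse; zip; drop; take; applyUpTo)
open import Data.List.Membership.Propositional using (_∈_)
open import Data.Product using (_×_; _,_; Σ)
open import Data.Sum using (_⊎_)
open import Relation.Nullary using (¬_; yes; no)
open import Relation.Binary.PropositionalEquality using (_≡_)

-- An orientation of the path A_{n-1} (vertices τ_1..τ_{n-1}).
-- Its n ∸ 2 edges are indexed by j : Fin (n ∸ 2); edge j is {τ_{j+1}, τ_{j+2}}.
-- o j ≡ true  means the edge is directed from τ_{j+2} to τ_{j+1};
-- o j ≡ false means it is directed from τ_{j+1} to τ_{j+2}.
Orientation : ℕ → Set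
Orientation n = Fin (n ∸ 2) → Bool

lookupℕ : {m : ℕ} → (Fin m → Bool) → ℕ → Bool
lookupℕ {m} f j with j <? m
... | yes p = f (fromℕ< p)
... | no _  = false

-- i ∈ {2..n-1} is up iff edge {τ_{i-1},τ_i} is directed from τ_i to τ_{i-1}
isUp : (n : ℕ) → Orientation n → ℕ → Bool
isUp n o i = (2 ≤ᵇ i) ∧ lookupℕ o (i ∸ 2)

-- down elements: the elements of [n] = {1..n} that are not up (so 1 and n are down)
isDown : (n : ℕ) → Orientation n → ℕ → Bool
isDown n o i = (1 ≤ᵇ i) ∧ (i ≤ᵇ n) ∧ not (isUp n o i)

isDownBar : (n : ℕ) → Orientation n → ℕ → Bool
isDownBar n o i = isDown n o i ∨ (i ≡ᵇ 0) ∨ (i ≡ᵇ suc n)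

filterᵇ : (ℕ → Bool) → List ℕ → List ℕ
filterᵇ p [] = []
filterᵇ p (x ∷ xs) = if p x then x ∷ filterᵇ p xs else filterᵇ p xs

range1 : ℕ → List ℕ
range1 n = applyUpTo suc n

polygonLabels : (n : ℕ) → Orientation n → List ℕ
polygonLabels n o =
  0 ∷ filterᵇ (isDown n o) (range1 n) ++ (suc n ∷ reverse (filterᵇ (isUp n o) (range1 n)))

cyclicPairs : List ℕ → List (ℕ × ℕ)
cyclicPairs l = zip l (drop 1 l ++ take 1 l)

Adjacent : (n : ℕ) → Orientation n → ℕ → ℕ → Set
Adjacent n o a b = ((a , b) ∈ cyclicPairs (polygonLabels n o)) ⊎ ((b , a) ∈ cyclicPairs (polygonLabels n o))

record Diagonal (n : ℕ) (o : Orientation n) : Set where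
  constructor diag
  field
    a b    : ℕ
    a<b    : a < b
    b≤n+1  : b ≤ suc n
    nonAdj : ¬ Adjacent n o a b

-- membership predicate of K_𝒜(D) (meaningful for i ∈ [n])
KA : (n : ℕ) → (o : Orientation n) → Diagonal n o → ℕ → Bool
KA n o (diag a b _ _ _) i =
  if isUp n o a
  then (if isUp n o b
        then isDown n o i ∨ (isUp n o i ∧ ((i ≤ᵇ a) ∨ (b ≤ᵇ i)))
        else (isDown n o i ∧ (i <ᵇ b)) ∨ (isUp n o i ∧ (i ≤ᵇ a)))
  else (if isUp n o b
        then (isDown n o i ∧ (a <ᵇ i)) ∨ (isUp n o i ∧ (b ≤ᵇ i))
        else isDown n o i ∧ (a <ᵇ i) ∧ (i <ᵇ b))

Admissible : (n : ℕ) → Orientation n → (ℕ → Bool) → Set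
Admissible n o K = Σ (Diagonal n o) λ D → ∀ i → 1 ≤ i → i ≤ n → KA n o D i ≡ K i

-- For the prefix {1,…,u} take a = the largest up element ≤ u (or 0) and b = the
-- smallest down element > u.  There is no up element in (a, u] and no down element
-- in (u, b), so K_𝒜({a,b}) = {down i < b} ∪ {up i ≤ a} is exactly {1,…,u}.
-- Symmetrically, for the suffix {w,…,n} take a = the largest down element < w and
-- b = the smallest up element ≥ w (or n+1), and K_𝒜({a,b}) = {down i > a} ∪ {up i ≥ b}.
-- Both pairs are diagonals: going round the labelled polygon, a down element is
-- never next to an up element, and among 0 and n+1 it can only be next to 0 if it
-- is 1, and next to n+1 if it is n.
module Submission where

open import Defs
open import Data.Nat using (ℕ; zero; suc; _+_; _∸_; _≤_; _<_; _≤ᵇ_; _<ᵇ_; z≤n; s≤s; s≤s⁻¹)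
open import Data.Nat.Properties
  using ( _≤?_; _<?_; ≤-refl; ≤-reflexive; ≤-trans; ≤-<-trans; <-≤-trans; <⇒≤; <⇒≢; <⇒≱; ≤⇒≯; ≮⇒≥
        ; <-irrefl; m≤n+m; m≤n⇒m≤1+n; m≤n⇒m<n∨m≡n; n≤1+n; +-suc; m+1+n≰m; m+n∸n≡m; m∸n+n≡m; ∸-monoʳ-≤; m∸n≤m)
open import Data.Bool using (Bool; true; false; _∧_; _∨_; not; if_then_else_)
open import Data.Bool.Properties using (∨-identityʳ; ∧-identityʳ; not-¬; not-injective)
open import Data.Fin using (Fin)
open import Data.List using (List; []; _∷_; _++_; reverse; zip; applyUpTo)
open import Data.List.Properties using (++-assoc; applyUpTo-∷ʳ)
open import Data.List.Relation.Unary.All as All using (All; []; _∷_)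
open import Data.List.Relation.Unary.Any using (here; there)
open import Data.List.Relation.Unary.Any.Properties using (reverse⁻)
open import Data.List.Relation.Unary.Linked using (Linked; [-]; _∷_)
open import Data.List.Membership.Propositional using (_∈_)
open import Data.Empty using (⊥)
open import Data.Product using (_×_; _,_; proj₁; proj₂)
open import Data.Sum using (_⊎_; inj₁; inj₂; swap; map₂)
open import Function using (_∘_)
open import Function.Bundles using (mk⇔)
open import Level using (Level)
open import Relation.Nullary using (¬_; yes; no; contradiction)
open import Relation.Nullary.Decidable using (does-⇔; dec-true; dec-false)
open import Relation.Unary using (Pred)
open import Relation.Binary using (Rel)
open import Relation.Binary.PropositionalEquality using (_≡_; refl; sym; trans; cong; subst; module ≡-Reasoning)

private
  variable
    ℓ ℓ′ : Level
    A : Set ℓ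

≤ᵇ-true : ∀ {m n} → m ≤ n → (m ≤ᵇ n) ≡ true
≤ᵇ-true = dec-true (_ ≤? _)

<ᵇ-true : ∀ {m n} → m < n → (m <ᵇ n) ≡ true
<ᵇ-true = dec-true (_ <? _)

<∸⇒+< : ∀ k {j m} → j < m ∸ k → k + j < m
<∸⇒+< zero              j<m   = j<m
<∸⇒+< (suc k) {m = zero} ()
<∸⇒+< (suc k) {m = suc m} j<m∸k = s≤s (<∸⇒+< k j<m∸k)

lookupℕ-true⇒< : ∀ {m} (f : Fin m → Bool) j → lookupℕ f j ≡ true → j < m
lookupℕ-true⇒< {m} f j eq with j <? m
... | yes j<m = j<m
... | no _    = contradiction eq λ ()

not∧∨∧≡if : ∀ x y z → (not x ∧ y) ∨ (x ∧ z) ≡ (if x then z else y)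
not∧∨∧≡if true  y z = refl
not∧∨∧≡if false y z = ∨-identityʳ y

filterᵇ-All : ∀ p xs → All (λ x → p x ≡ true) (filterᵇ p xs)
filterᵇ-All p []       = []
filterᵇ-All p (x ∷ xs) with p x in px
... | true  = px ∷ filterᵇ-All p xs
... | false = filterᵇ-All p xs

filterᵇ-++ : ∀ p xs ys → filterᵇ p (xs ++ ys) ≡ filterᵇ p xs ++ filterᵇ p ys
filterᵇ-++ p []       ys = refl
filterᵇ-++ p (x ∷ xs) ys with p x
... | true  = cong (x ∷_) (filterᵇ-++ p xs ys)
... | false = filterᵇ-++ p xs ys

filterᵇ-∷ʳ : ∀ p xs {x} → p x ≡ true → filterᵇ p (xs ++ x ∷ []) ≡ filterᵇ p xs ++ x ∷ []
filterᵇ-∷ʳ p xs {x} px rewrite filterᵇ-++ p xs (x ∷ []) | px = refl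

filterᵇ-range1 : ∀ p {n} → 2 ≤ n → p 1 ≡ true → p n ≡ true →
                 filterᵇ p (range1 n) ≡ 1 ∷ filterᵇ p (applyUpTo (2 +_) (n ∸ 2)) ++ n ∷ []
filterᵇ-range1 p {suc (suc k)} (s≤s (s≤s _)) p1 pn rewrite p1 = cong (1 ∷_) (begin
  filterᵇ p (applyUpTo (2 +_) (suc k))         ≡⟨ cong (filterᵇ p) (sym (applyUpTo-∷ʳ (2 +_) k)) ⟩
  filterᵇ p (applyUpTo (2 +_) k ++ 2 + k ∷ []) ≡⟨ filterᵇ-∷ʳ p (applyUpTo (2 +_) k) pn ⟩
  filterᵇ p (applyUpTo (2 +_) k) ++ 2 + k ∷ [] ∎)
  where open ≡-Reasoning

All-reverse : ∀ {P : Pred A ℓ′} {xs} → All P xs → All P (reverse xs)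
All-reverse pxs = All.tabulate (λ x∈ → All.lookup pxs (reverse⁻ x∈))

Linked-++-clique : ∀ {P : Pred A ℓ′} {R : Rel A ℓ′} {x xs y ys} →
                   (∀ {u v} → P u → P v → R u v) → All P (x ∷ xs) → P y →
                   Linked R (y ∷ ys) → Linked R (x ∷ xs ++ y ∷ ys)
Linked-++-clique R-P (px ∷ [])       py l = R-P px py ∷ l
Linked-++-clique R-P (px ∷ pz ∷ pzs) py l = R-P px pz ∷ Linked-++-clique R-P (pz ∷ pzs) py l

Linked-zip-∈ : ∀ {R : Rel A ℓ′} {h t z x y} → Linked R (h ∷ t ++ z ∷ []) →
               (x , y) ∈ zip (h ∷ t) (t ++ z ∷ []) → R x y
Linked-zip-∈ {t = []}    (r ∷ _) (here refl) = r
Linked-zip-∈ {t = []}    _       (there ())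
Linked-zip-∈ {t = _ ∷ _} (r ∷ _) (here refl) = r
Linked-zip-∈ {t = _ ∷ _} (_ ∷ l) (there xy∈) = Linked-zip-∈ l xy∈

lastUpTo : (ℕ → Bool) → ℕ → ℕ
lastUpTo p zero    = zero
lastUpTo p (suc m) = if p (suc m) then suc m else lastUpTo p m

lastUpTo-≤ : ∀ p m → lastUpTo p m ≤ m
lastUpTo-≤ p zero = z≤n
lastUpTo-≤ p (suc m) with p (suc m)
... | true  = ≤-refl
... | false = m≤n⇒m≤1+n (lastUpTo-≤ p m)

lastUpTo-hit : ∀ p m → p (lastUpTo p m) ≡ true ⊎ lastUpTo p m ≡ 0
lastUpTo-hit p zero = inj₂ refl
lastUpTo-hit p (suc m) with p (suc m) in psm
... | true  = inj₁ psm
... | false = lastUpTo-hit p m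

lastUpTo-max : ∀ p {m i} → p i ≡ true → i ≤ m → i ≤ lastUpTo p m
lastUpTo-max p {zero}  _  z≤n = z≤n
lastUpTo-max p {suc m} pi i≤1+m with p (suc m) in psm
... | true = i≤1+m
... | false with m≤n⇒m<n∨m≡n i≤1+m
...   | inj₁ i<1+m = lastUpTo-max p pi (s≤s⁻¹ i<1+m)
...   | inj₂ refl  = contradiction (trans (sym pi) psm) λ ()

firstFrom : (ℕ → Bool) → ℕ → ℕ → ℕ
firstFrom p zero    m = m
firstFrom p (suc f) m = if p m then m else firstFrom p f (suc m)

firstFrom-≥ : ∀ p f m → m ≤ firstFrom p f m
firstFrom-≥ p zero    m = ≤-refl
firstFrom-≥ p (suc f) m with p m
... | true  = ≤-refl
... | false = <⇒≤ (firstFrom-≥ p f (suc m))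

firstFrom-≤ : ∀ p f m → firstFrom p f m ≤ f + m
firstFrom-≤ p zero    m = ≤-refl
firstFrom-≤ p (suc f) m with p m
... | true  = m≤n⇒m≤1+n (m≤n+m m f)
... | false = subst (firstFrom p f (suc m) ≤_) (+-suc f m) (firstFrom-≤ p f (suc m))

firstFrom-hit : ∀ p f m → p (firstFrom p f m) ≡ true ⊎ firstFrom p f m ≡ f + m
firstFrom-hit p zero    m = inj₂ refl
firstFrom-hit p (suc f) m with p m in pm
... | true  = inj₁ pm
... | false = map₂ (λ eq → trans eq (+-suc f m)) (firstFrom-hit p f (suc m))

firstFrom-min : ∀ p f {m i} → m ≤ i → p i ≡ true → firstFrom p f m ≤ i
firstFrom-min p zero    m≤i _ = m≤i
firstFrom-min p (suc f) {m} m≤i pi with p m in pm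
... | true = m≤i
... | false with m≤n⇒m<n∨m≡n m≤i
...   | inj₁ m<i = firstFrom-min p f m<i pi
...   | inj₂ refl = contradiction (trans (sym pi) pm) λ ()

module _ (n : ℕ) (o : Orientation n) where

  isUp-< : ∀ {i} → isUp n o i ≡ true → i < n
  isUp-< {zero}        ()
  isUp-< {suc zero}    ()
  isUp-< {suc (suc j)} eq = <∸⇒+< 2 (lookupℕ-true⇒< o j eq)

  isUp-≥ : ∀ {i} → n ≤ i → isUp n o i ≡ false
  isUp-≥ {i} n≤i with isUp n o i in up
  ... | true  = contradiction (isUp-< up) (≤⇒≯ n≤i)
  ... | false = refl

  isDown≡not-isUp : ∀ {i} → 1 ≤ i → i ≤ n → isDown n o i ≡ not (isUp n o i)
  isDown≡not-isUp 1≤i i≤n rewrite ≤ᵇ-true 1≤i | ≤ᵇ-true i≤n = refl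

  isDown-nonUp : ∀ {i} → 1 ≤ i → i ≤ n → isUp n o i ≡ false → isDown n o i ≡ true
  isDown-nonUp 1≤i i≤n low = trans (isDown≡not-isUp 1≤i i≤n) (cong not low)

  isDown-top : isDown n o (suc n) ≡ false
  isDown-top rewrite dec-false (suc n ≤? n) (<-irrefl refl) = refl

  isDown⇒¬isUp : ∀ {i} → isDown n o i ≡ true → isUp n o i ≡ false
  isDown⇒¬isUp {i} down with 1 ≤ᵇ i | i ≤ᵇ n | isUp n o i
  ... | true  | true  | false = refl
  ... | true  | true  | true  = contradiction down λ ()
  ... | true  | false | _     = contradiction down λ ()
  ... | false | _     | _     = contradiction down λ ()

  isUp⇒¬isDown : ∀ {i} → isUp n o i ≡ true → isDown n o i ≡ false
  isUp⇒¬isDown {i} up with isDown n o i in down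
  ... | true  = contradiction up (not-¬ (isDown⇒¬isUp {i} down))
  ... | false = refl

  record NeighbourOfDown (d e : ℕ) : Set where
    field
      not-up  : isUp n o e ≡ false
      at-zero : e ≡ 0 → d ≡ 1
      at-top  : e ≡ suc n → d ≡ n

  open NeighbourOfDown

  ValidEdge : ℕ → ℕ → Set
  ValidEdge x y = (isDown n o x ≡ true → NeighbourOfDown x y)
                × (isDown n o y ≡ true → NeighbourOfDown y x)

  down-neighbour : ∀ {d e} → isDown n o e ≡ true → NeighbourOfDown d e
  down-neighbour {e = e} down = record
    { not-up  = isDown⇒¬isUp {e} down
    ; at-zero = λ { refl → contradiction down λ () }
    ; at-top  = λ { refl → contradiction down (not-¬ isDown-top) }
    }

  edge-down-down : ∀ {x y} → isDown n o x ≡ true → isDown n o y ≡ true → ValidEdge x y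
  edge-down-down dx dy = (λ _ → down-neighbour dy) , (λ _ → down-neighbour dx)

  edge-nonDown : ∀ {x y} → isDown n o x ≡ false → isDown n o y ≡ false → ValidEdge x y
  edge-nonDown nx ny = (λ dx → contradiction dx (not-¬ nx)) , (λ dy → contradiction dy (not-¬ ny))

  edge-zero-one : ValidEdge 0 1
  edge-zero-one = (λ ()) , λ _ → record { not-up = refl ; at-zero = λ _ → refl ; at-top = λ () }

  edge-n-top : ValidEdge n (suc n)
  edge-n-top = (λ _ → record { not-up = isUp-≥ (n≤1+n n) ; at-zero = λ () ; at-top = λ _ → refl })
             , λ down → contradiction down (not-¬ isDown-top)

  isDown-one : 1 ≤ n → isDown n o 1 ≡ true
  isDown-one 1≤n = isDown-nonUp ≤-refl 1≤n refl

  isDown-n : 1 ≤ n → isDown n o n ≡ true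
  isDown-n 1≤n = isDown-nonUp 1≤n ≤-refl (isUp-≥ ≤-refl)

  innerDowns : List ℕ
  innerDowns = filterᵇ (isDown n o) (applyUpTo (2 +_) (n ∸ 2))

  upLabels : List ℕ
  upLabels = reverse (filterᵇ (isUp n o) (range1 n))

  polygonLabels-split : 2 ≤ n → polygonLabels n o ++ 0 ∷ [] ≡ 0 ∷ 1 ∷ innerDowns ++ n ∷ suc n ∷ upLabels ++ 0 ∷ []
  polygonLabels-split 2≤n
    rewrite filterᵇ-range1 (isDown n o) 2≤n (isDown-one (<⇒≤ 2≤n)) (isDown-n (<⇒≤ 2≤n))
          | ++-assoc innerDowns (n ∷ []) (suc n ∷ upLabels)
          | ++-assoc innerDowns (n ∷ suc n ∷ upLabels) (0 ∷ [])
    = refl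

  polygon-linked : 2 ≤ n → Linked ValidEdge (polygonLabels n o ++ 0 ∷ [])
  polygon-linked 2≤n rewrite polygonLabels-split 2≤n =
    edge-zero-one ∷ Linked-++-clique edge-down-down (isDown-one 1≤n ∷ innerDowns-down) (isDown-n 1≤n)
      (edge-n-top ∷ Linked-++-clique edge-nonDown (isDown-top ∷ upLabels-nonDown) refl [-])
    where
    1≤n : 1 ≤ n
    1≤n = <⇒≤ 2≤n
    innerDowns-down : All (λ x → isDown n o x ≡ true) innerDowns
    innerDowns-down = filterᵇ-All (isDown n o) (applyUpTo (2 +_) (n ∸ 2))
    upLabels-nonDown : All (λ x → isDown n o x ≡ false) upLabels
    upLabels-nonDown = All-reverse (All.map (λ {x} → isUp⇒¬isDown {x}) (filterᵇ-All (isUp n o) (range1 n)))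

  adjacent-down : ∀ {d e} → 2 ≤ n → Adjacent n o d e → isDown n o d ≡ true → NeighbourOfDown d e
  adjacent-down 2≤n (inj₁ de∈) down = proj₁ (Linked-zip-∈ (polygon-linked 2≤n) de∈) down
  adjacent-down 2≤n (inj₂ ed∈) down = proj₂ (Linked-zip-∈ (polygon-linked 2≤n) ed∈) down

  ¬adjacent-low-down : ∀ {a b} → isUp n o a ≡ true ⊎ a ≡ 0 → 2 ≤ b → b ≤ n → isUp n o b ≡ false →
                       ¬ Adjacent n o a b
  ¬adjacent-low-down {a} {b} a-class 2≤b b≤n b-low adj = excluded a-class
    where
    nb : NeighbourOfDown b a
    nb = adjacent-down (≤-trans 2≤b b≤n) (swap adj) (isDown-nonUp (<⇒≤ 2≤b) b≤n b-low)
    excluded : isUp n o a ≡ true ⊎ a ≡ 0 → ⊥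
    excluded (inj₁ a-up) = not-¬ (not-up nb) a-up
    excluded (inj₂ a≡0)  = <-irrefl refl (subst (2 ≤_) (at-zero nb a≡0) 2≤b)

  ¬adjacent-down-high : ∀ {a b} → 1 ≤ a → a < n → isUp n o a ≡ false → isUp n o b ≡ true ⊎ b ≡ suc n →
                        ¬ Adjacent n o a b
  ¬adjacent-down-high {a} {b} 1≤a a<n a-low b-class adj = excluded b-class
    where
    na : NeighbourOfDown a b
    na = adjacent-down (≤-<-trans 1≤a a<n) adj (isDown-nonUp 1≤a (<⇒≤ a<n) a-low)
    excluded : isUp n o b ≡ true ⊎ b ≡ suc n → ⊥
    excluded (inj₁ b-up)   = not-¬ (not-up na) b-up
    excluded (inj₂ b≡1+n) = <⇒≢ a<n (at-top na b≡1+n)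

  KA-lower : (D : Diagonal n o) → isUp n o (Diagonal.b D) ≡ false →
             isUp n o (Diagonal.a D) ≡ true ⊎ Diagonal.a D ≡ 0 →
             ∀ {i} → 1 ≤ i → i ≤ n →
             KA n o D i ≡ (if isUp n o i then i ≤ᵇ Diagonal.a D else i <ᵇ Diagonal.b D)
  KA-lower (diag a b _ _ _) b-low (inj₁ a-up) {i} 1≤i i≤n
    rewrite a-up | b-low | isDown≡not-isUp 1≤i i≤n = not∧∨∧≡if (isUp n o i) (i <ᵇ b) (i ≤ᵇ a)
  KA-lower (diag _ b _ _ _) b-low (inj₂ refl) {suc j} 1≤i i≤n
    rewrite b-low | isDown≡not-isUp 1≤i i≤n with isUp n o (suc j)
  ... | true  = refl
  ... | false = refl

  KA-upper : (D : Diagonal n o) → isUp n o (Diagonal.a D) ≡ false →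
             isUp n o (Diagonal.b D) ≡ true ⊎ Diagonal.b D ≡ suc n →
             ∀ {i} → 1 ≤ i → i ≤ n →
             KA n o D i ≡ (if isUp n o i then Diagonal.b D ≤ᵇ i else Diagonal.a D <ᵇ i)
  KA-upper (diag a b _ _ _) a-low (inj₁ b-up) {i} 1≤i i≤n
    rewrite a-low | b-up | isDown≡not-isUp 1≤i i≤n = not∧∨∧≡if (isUp n o i) (a <ᵇ i) (b ≤ᵇ i)
  KA-upper (diag a _ _ _ _) a-low (inj₂ refl) {i} 1≤i i≤n
    rewrite a-low | isUp-≥ (n≤1+n n) | isDown≡not-isUp 1≤i i≤n
          | <ᵇ-true (s≤s i≤n) | ∧-identityʳ (a <ᵇ i) with isUp n o i
  ... | true  = sym (dec-false (suc n ≤? i) (≤⇒≯ i≤n))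
  ... | false = refl

  prefix-admissible : ∀ {u a b} → 1 ≤ u → a ≤ u → u < b → b ≤ n →
    isUp n o a ≡ true ⊎ a ≡ 0 → isUp n o b ≡ false →
    (∀ {i} → isUp n o i ≡ true → i ≤ u → i ≤ a) →
    (∀ {i} → isUp n o i ≡ false → u < i → b ≤ i) →
    Admissible n o (λ i → i ≤ᵇ u)
  prefix-admissible {u} {a} {b} 1≤u a≤u u<b b≤n a-class b-low up-max low-min = D , KA≡
    where
    2≤b : 2 ≤ b
    2≤b = ≤-trans (s≤s 1≤u) u<b

    D : Diagonal n o
    D = diag a b (≤-<-trans a≤u u<b) (m≤n⇒m≤1+n b≤n)
             (¬adjacent-low-down a-class 2≤b b≤n b-low)

    KA≡ : ∀ i → 1 ≤ i → i ≤ n → KA n o D i ≡ (i ≤ᵇ u)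
    KA≡ i 1≤i i≤n rewrite KA-lower D b-low a-class 1≤i i≤n with isUp n o i in up
    ... | true  = does-⇔ (mk⇔ (λ i≤a → ≤-trans i≤a a≤u) (up-max up)) (i ≤? a) (i ≤? u)
    ... | false = does-⇔ (mk⇔ (λ i<b → ≮⇒≥ λ u<i → <⇒≱ i<b (low-min up u<i))
                              (λ i≤u → ≤-<-trans i≤u u<b)) (i <? b) (i ≤? u)

  suffix-admissible : ∀ {w a b} → 1 ≤ a → a < w → w ≤ b → w ≤ n → b ≤ suc n →
    isUp n o a ≡ false → isUp n o b ≡ true ⊎ b ≡ suc n →
    (∀ {i} → isUp n o i ≡ false → i < w → i ≤ a) →
    (∀ {i} → isUp n o i ≡ true → w ≤ i → b ≤ i) →
    Admissible n o (λ i → w ≤ᵇ i)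
  suffix-admissible {w} {a} {b} 1≤a a<w w≤b w≤n b≤1+n a-low b-class low-max up-min = D , KA≡
    where
    D : Diagonal n o
    D = diag a b (<-≤-trans a<w w≤b) b≤1+n (¬adjacent-down-high 1≤a (<-≤-trans a<w w≤n) a-low b-class)

    KA≡ : ∀ i → 1 ≤ i → i ≤ n → KA n o D i ≡ (w ≤ᵇ i)
    KA≡ i 1≤i i≤n rewrite KA-upper D a-low b-class 1≤i i≤n with isUp n o i in up
    ... | true  = does-⇔ (mk⇔ (≤-trans w≤b) (up-min up)) (b ≤? i) (w ≤? i)
    ... | false = does-⇔ (mk⇔ (λ a<i → ≮⇒≥ λ i<w → <⇒≱ a<i (low-max up i<w))
                              (λ w≤i → <-≤-trans a<w w≤i)) (a <? i) (w ≤? i)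

  prefixes-admissible : ∀ {u} → 1 ≤ u → u < n → Admissible n o (λ i → i ≤ᵇ u)
  prefixes-admissible {u} 1≤u u<n =
    prefix-admissible 1≤u (lastUpTo-≤ (isUp n o) u) (firstFrom-≥ nonUp n (suc u)) b≤n
      (lastUpTo-hit (isUp n o) u) b-low (lastUpTo-max (isUp n o))
      (λ low u<i → firstFrom-min nonUp n u<i (cong not low))
    where
    nonUp : ℕ → Bool
    nonUp = not ∘ isUp n o
    b : ℕ
    b = firstFrom nonUp n (suc u)
    b≤n : b ≤ n
    b≤n = firstFrom-min nonUp n u<n (cong not (isUp-≥ ≤-refl))
    b-low : isUp n o b ≡ false
    b-low with firstFrom-hit nonUp n (suc u)
    ... | inj₁ hit = not-injective {y = false} hit
    ... | inj₂ b≡  = contradiction (subst (_≤ n) b≡ b≤n) (m+1+n≰m n)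

  suffixes-admissible : ∀ {w} → 2 ≤ w → w ≤ n → Admissible n o (λ i → w ≤ᵇ i)
  suffixes-admissible {suc m} (s≤s 1≤m) w≤n =
    suffix-admissible 1≤a (s≤s (lastUpTo-≤ nonUp m)) (firstFrom-≥ (isUp n o) fuel (suc m)) w≤n
      (subst (b ≤_) fuel+w≡1+n (firstFrom-≤ (isUp n o) fuel (suc m))) a-low
      (map₂ (λ b≡ → trans b≡ fuel+w≡1+n) (firstFrom-hit (isUp n o) fuel (suc m)))
      (λ low i<w → lastUpTo-max nonUp (cong not low) (s≤s⁻¹ i<w))
      (λ up w≤i → firstFrom-min (isUp n o) fuel w≤i up)
    where
    nonUp : ℕ → Bool
    nonUp = not ∘ isUp n o
    a : ℕ
    a = lastUpTo nonUp m
    1≤a : 1 ≤ a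
    1≤a = lastUpTo-max nonUp refl 1≤m
    a-low : isUp n o a ≡ false
    a-low with lastUpTo-hit nonUp m
    ... | inj₁ hit = not-injective {y = false} hit
    ... | inj₂ a≡0 = contradiction (subst (1 ≤_) a≡0 1≤a) λ ()
    fuel : ℕ
    fuel = suc n ∸ suc m
    fuel+w≡1+n : fuel + suc m ≡ suc n
    fuel+w≡1+n = m∸n+n≡m (m≤n⇒m≤1+n w≤n)
    b : ℕ
    b = firstFrom (isUp n o) fuel (suc m)

lemma2p2 : (n : ℕ) → 2 ≤ n → (o : Orientation n) →
    ((u : ℕ) → 1 ≤ u → u ≤ n ∸ 1 → Admissible n o (λ i → i ≤ᵇ u))
    × ((v : ℕ) → v ≤ n ∸ 2 → Admissible n o (λ i → (n ∸ v) ≤ᵇ i))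
lemma2p2 n@(suc (suc k)) (s≤s (s≤s _)) o =
    (λ u 1≤u u≤1+k → prefixes-admissible n o 1≤u (s≤s u≤1+k))
  , (λ v v≤k → suffixes-admissible n o (2≤n∸v v≤k) (m∸n≤m n v))
  where
  2≤n∸v : ∀ {v} → v ≤ k → 2 ≤ n ∸ v
  2≤n∸v v≤k = ≤-trans (≤-reflexive (sym (m+n∸n≡m 2 k))) (∸-monoʳ-≤ n v≤k)
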